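{- Let $k\ge1$ and let $\mathcal{S}=\mathrm{CSP}\times \mathcal{C}$ with the order $\preceq_{\mathcal S}$ defined below, and let $\mathcal{L}^*=\mathcal{L}_0^k$ with the componentwise (product) order $\preceq$, where $\mathcal{L}_0=[3]\times[4]$ is ordered by $(x_1,y_1)\preceq_0(x_2,y_2)$ iff $x_1\le x_2$ and ($y_2=4$ or $y_1=1$ or $y_1=y_2$). Define $\rho:\mathcal S\to\mathcal L^*$ by $\rho(p,c)=((x_1,y_1),\dots,(x_k,y_k))$ where $x_i=3$ if $i\in Z_p$, $x_i=2$ if $i\in \mathrm{lbs}(p)\setminus Z_p$, $x_i=1$ otherwise, and $y_i=1,2,3,4$ according as $c(i)=\emptyset,\{\mathsf{b}\},\{\mathsf{w}\},\{\mathsf{b},\mathsf{w}\}$. Then $\rho$ is an order isomorphism between $(\mathcal S,\preceq_{\mathcal S})$ and $(\mathcal L^*,\preceq)$.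
   Context: A CS-pattern (over labels $[k]=\{1,\dots,k\}$) is determined by a pair $(X,Y)$ with $Y\subseteq X\subseteq[k]$: it is the family $\{\{u\}:u\in X\}\cup\{\{0\}\cup Y\}$; write $\mathrm{lbs}(p)=X$ and $Z_p=\{0\}\cup Y$ (its zero-set; membership $i\in Z_p$ for $i\in[k]$ means $i\in Y$). $\mathrm{CSP}$ is the set of all CS-patterns, ordered by $p\le q$ iff $Z_p\subseteq Z_q$ and $\mathrm{lbs}(p)\subseteq\mathrm{lbs}(q)$. A coloring is a map $c:[k]\to\{\emptyset,\{\mathsf b\},\{\mathsf w\},\{\mathsf b,\mathsf w\}\}$; $\mathcal C$ is the set of all colorings, ordered by $c_1\le c_2$ iff $c_1(i)\subseteq c_2(i)$ for all $i$. The order on $\mathcal S=\mathrm{CSP}\times\mathcal C$ is $(p_1,c_1)\preceq_{\mathcal S}(p_2,c_2)$ iff $p_1\le p_2$ and $c_1\le c_2$. -}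

module Defs where

open import Data.Nat using (ℕ; suc)
open import Data.Bool using (Bool; true; false)
open import Data.Fin using (Fin; zero; suc) renaming (_≤_ to _≤F_)
open import Data.Fin.Subset using (Subset; _⊆_; _∈_)
open import Data.Vec using (Vec; []; _∷_; lookup; tabulate)
open import Data.Product using (_×_; _,_; Σ; proj₁; proj₂)
open import Data.Sum using (_⊎_)
open import Relation.Binary.PropositionalEquality using (_≡_)
open import Function.Bundles using (_⇔_)

-- A CS-pattern over [k] is determined by (X , Y) with Y ⊆ X ⊆ [k].
-- Label i ∈ [k] is represented by (i : Fin k). The side condition is an
-- irrelevant field, so patterns are equal iff their (X , Y) are equal.
record CSP (k : ℕ) : Set where
  constructor csp
  field
    X : Subset k
    Y : Subset k
    .wf : Y ⊆ X

open CSP public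

lbs : ∀ {k} → CSP k → Subset k
lbs p = X p

-- Z_p = {0} ∪ Y, as a subset of {0,1,…,k}: index zero is 0, index (suc i) is label i.
Z : ∀ {k} → CSP k → Subset (suc k)
Z p = true ∷ Y p

_≤CSP_ : ∀ {k} → CSP k → CSP k → Set
p ≤CSP q = (Z p ⊆ Z q) × (lbs p ⊆ lbs q)

-- Colors: subsets of {b , w}; index zero = b, index (suc zero) = w.
Color : Set
Color = Subset 2

Coloring : ℕ → Set
Coloring k = Vec Color k

_≤C_ : ∀ {k} → Coloring k → Coloring k → Set
c₁ ≤C c₂ = ∀ i → lookup c₁ i ⊆ lookup c₂ i

𝒮 : ℕ → Set
𝒮 k = CSP k × Coloring k

_≼𝒮_ : ∀ {k} → 𝒮 k → 𝒮 k → Set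
(p₁ , c₁) ≼𝒮 (p₂ , c₂) = (p₁ ≤CSP p₂) × (c₁ ≤C c₂)

-- L₀ = [3] × [4]; the value j ∈ [n] is represented by (j - 1 : Fin n).
L₀ : Set
L₀ = Fin 3 × Fin 4

four : Fin 4
four = suc (suc (suc zero))

_≼₀_ : L₀ → L₀ → Set
(x₁ , y₁) ≼₀ (x₂ , y₂) = (x₁ ≤F x₂) × ((y₂ ≡ four) ⊎ (y₁ ≡ zero) ⊎ (y₁ ≡ y₂))

L* : ℕ → Set
L* k = Vec L₀ k

_≼_ : ∀ {k} → L* k → L* k → Set
l₁ ≼ l₂ = ∀ i → lookup l₁ i ≼₀ lookup l₂ i

xval : Bool → Bool → Fin 3
xval true  _     = suc (suc zero)
xval false true  = suc zero
xval false false = zero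

xcoord : ∀ {k} → CSP k → Fin k → Fin 3
xcoord p i = xval (lookup (Z p) (suc i)) (lookup (lbs p) i)

yval : Color → Fin 4
yval (false ∷ false ∷ []) = zero
yval (true  ∷ false ∷ []) = suc zero
yval (false ∷ true  ∷ []) = suc (suc zero)
yval (true  ∷ true  ∷ []) = four

ρ : ∀ {k} → 𝒮 k → L* k
ρ (p , c) = tabulate (λ i → (xcoord p i , yval (lookup c i)))

record IsOrderIso {A B : Set} (_≤A_ : A → A → Set) (_≤B_ : B → B → Set)
                  (f : A → B) : Set where
  field
    injective  : ∀ a₁ a₂ → f a₁ ≡ f a₂ → a₁ ≡ a₂
    surjective : ∀ b → Σ A (λ a → f a ≡ b)
    order      : ∀ a₁ a₂ → (a₁ ≤A a₂) ⇔ (f a₁ ≤B f a₂)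

{-# OPTIONS --safe #-}
-- Both orders are products over the labels i ∈ [k], and ρ acts label by label.
-- Because Y ⊆ X, the pair (i ∈ Z_p , i ∈ lbs p) ranges over the three-element chain
-- (no,no) < (no,yes) < (yes,yes), which xval maps isomorphically onto [3]; the colour
-- c(i) ranges over the Boolean lattice of subsets of {b,w}, which yval maps
-- isomorphically onto [4] with the diamond order 1 < 2,3 < 4.  Order reflection then
-- gives injectivity, because ≼𝒮 is antisymmetric.
module Submission where

open import Defs
open import Data.Nat using (ℕ; _≤_; z≤n; s≤s)
open import Data.Bool using (Bool; true; false; b≤b; f≤t) renaming (_≤_ to _≤ᵇ_)
open import Data.Bool.Properties using (≤-minimum; ≤-maximum; _≤?_)
open import Data.Fin using (Fin; zero; suc) renaming (_≤_ to _≤F_)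
open import Data.Fin.Properties using (≤fromℕ) renaming (≤-refl to ≤F-refl)
open import Data.Fin.Subset using (Subset; _⊆_; inside; outside)
open import Data.Fin.Subset.Properties using (drop-∷-⊆; in⊆in; ⊆-refl; ⊆-antisym; ⊆⊤; ⊥⊆)
open import Data.Vec using ([]; _∷_; here; there; lookup; tabulate)
open import Data.Vec.Properties using (lookup∘tabulate; tabulate∘lookup; tabulate-cong)
open import Data.Vec.Relation.Binary.Pointwise.Extensional using (ext; Pointwise-≡⇒≡)
open import Data.Product using (_×_; _,_; Σ; proj₁; proj₂)
open import Data.Sum using (_⊎_; inj₁; inj₂)
open import Relation.Binary.PropositionalEquality using (_≡_; refl; sym; trans; cong; cong₂; subst; subst₂; module ≡-Reasoning)
open import Relation.Nullary using (recompute)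
open import Function.Base using (_∘_)
open import Function.Bundles using (_⇔_; mk⇔; module Equivalence)

order-reflecting⇒injective :
  ∀ {A B : Set} {_≤A_ : A → A → Set} {_≤B_ : B → B → Set} →
  (∀ {a₁ a₂} → a₁ ≤A a₂ → a₂ ≤A a₁ → a₁ ≡ a₂) → (∀ b → b ≤B b) →
  (f : A → B) → (∀ a₁ a₂ → f a₁ ≤B f a₂ → a₁ ≤A a₂) →
  ∀ a₁ a₂ → f a₁ ≡ f a₂ → a₁ ≡ a₂
order-reflecting⇒injective {_≤B_ = _≤B_} antisym reflB f reflects a₁ a₂ fa₁≡fa₂ =
  antisym (reflects a₁ a₂ (subst (f a₁ ≤B_) fa₁≡fa₂ (reflB (f a₁))))
          (reflects a₂ a₁ (subst (_≤B f a₁) fa₁≡fa₂ (reflB (f a₁))))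

⊆⇒lookup-≤ : ∀ {n} {p q : Subset n} → p ⊆ q → ∀ i → lookup p i ≤ᵇ lookup q i
⊆⇒lookup-≤ {p = outside ∷ _}          _   zero = ≤-minimum _
⊆⇒lookup-≤ {p = inside ∷ _} {_ ∷ _}   p⊆q zero with p⊆q here
... | here = b≤b
⊆⇒lookup-≤ {p = _ ∷ _}      {_ ∷ _}   p⊆q (suc i) = ⊆⇒lookup-≤ (drop-∷-⊆ p⊆q) i

lookup-≤⇒⊆ : ∀ {n} {p q : Subset n} → (∀ i → lookup p i ≤ᵇ lookup q i) → p ⊆ q
lookup-≤⇒⊆ {p = _ ∷ _} {_ ∷ _} p≤q here with p≤q zero
... | b≤b = here
lookup-≤⇒⊆ {p = _ ∷ _} {_ ∷ _} p≤q (there i∈p) = there (lookup-≤⇒⊆ (λ i → p≤q (suc i)) i∈p)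

z-bit : Fin 3 → Bool
z-bit (suc (suc zero)) = true
z-bit _                = false

lbs-bit : Fin 3 → Bool
lbs-bit zero    = false
lbs-bit (suc _) = true

z-bit≤lbs-bit : ∀ a → z-bit a ≤ᵇ lbs-bit a
z-bit≤lbs-bit zero             = b≤b
z-bit≤lbs-bit (suc zero)       = f≤t
z-bit≤lbs-bit (suc (suc zero)) = b≤b

xval-bits : ∀ a → xval (z-bit a) (lbs-bit a) ≡ a
xval-bits zero             = refl
xval-bits (suc zero)       = refl
xval-bits (suc (suc zero)) = refl

z-bit-xval : ∀ z x → z-bit (xval z x) ≡ z
z-bit-xval true  _     = refl
z-bit-xval false false = refl
z-bit-xval false true  = refl

lbs-bit-xval : ∀ {z x} → z ≤ᵇ x → lbs-bit (xval z x) ≡ x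
lbs-bit-xval {false} b≤b = refl
lbs-bit-xval {true}  b≤b = refl
lbs-bit-xval         f≤t = refl

z-bit-mono : ∀ {a b} → a ≤F b → z-bit a ≤ᵇ z-bit b
z-bit-mono {b = suc (suc zero)}           _            = ≤-maximum _
z-bit-mono {zero}                         _            = ≤-minimum _
z-bit-mono {suc zero}                     _            = ≤-minimum _
z-bit-mono {suc (suc zero)} {suc zero}    (s≤s ())

lbs-bit-mono : ∀ {a b} → a ≤F b → lbs-bit a ≤ᵇ lbs-bit b
lbs-bit-mono {zero}            _ = ≤-minimum _
lbs-bit-mono {suc _} {suc _}   _ = b≤b

xval-mono : ∀ {z₁ x₁ z₂ x₂} → z₁ ≤ᵇ z₂ → x₁ ≤ᵇ x₂ → xval z₁ x₁ ≤F xval z₂ x₂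
xval-mono {z₂ = true}  _   _   = ≤fromℕ _
xval-mono {z₂ = false} b≤b b≤b = ≤F-refl
xval-mono {z₂ = false} b≤b f≤t = z≤n

xval-reflects : ∀ {z₁ x₁ z₂ x₂} → z₁ ≤ᵇ x₁ → z₂ ≤ᵇ x₂ →
                xval z₁ x₁ ≤F xval z₂ x₂ → z₁ ≤ᵇ z₂ × x₁ ≤ᵇ x₂
xval-reflects {z₁} {x₁} {z₂} {x₂} z₁≤x₁ z₂≤x₂ ≤₃ =
  subst₂ _≤ᵇ_ (z-bit-xval z₁ x₁) (z-bit-xval z₂ x₂) (z-bit-mono ≤₃) ,
  subst₂ _≤ᵇ_ (lbs-bit-xval z₁≤x₁) (lbs-bit-xval z₂≤x₂) (lbs-bit-mono ≤₃)

_≼₄_ : Fin 4 → Fin 4 → Set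
y₁ ≼₄ y₂ = (y₂ ≡ four) ⊎ (y₁ ≡ zero) ⊎ (y₁ ≡ y₂)

color : Fin 4 → Color
color zero                   = false ∷ false ∷ []
color (suc zero)             = true  ∷ false ∷ []
color (suc (suc zero))       = false ∷ true  ∷ []
color (suc (suc (suc zero))) = true  ∷ true  ∷ []

yval-color : ∀ y → yval (color y) ≡ y
yval-color zero                   = refl
yval-color (suc zero)             = refl
yval-color (suc (suc zero))       = refl
yval-color (suc (suc (suc zero))) = refl

color-yval : ∀ c → color (yval c) ≡ c
color-yval (false ∷ false ∷ []) = refl
color-yval (true  ∷ false ∷ []) = refl
color-yval (false ∷ true  ∷ []) = refl
color-yval (true  ∷ true  ∷ []) = refl

color-mono : ∀ {y₁ y₂} → y₁ ≼₄ y₂ → color y₁ ⊆ color y₂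
color-mono (inj₁ refl)        = ⊆⊤
color-mono (inj₂ (inj₁ refl)) = ⊥⊆
color-mono (inj₂ (inj₂ refl)) = ⊆-refl

yval-mono-bits : ∀ {b₁ w₁ b₂ w₂} → b₁ ≤ᵇ b₂ → w₁ ≤ᵇ w₂ →
                 yval (b₁ ∷ w₁ ∷ []) ≼₄ yval (b₂ ∷ w₂ ∷ [])
yval-mono-bits                     b≤b b≤b = inj₂ (inj₂ refl)
yval-mono-bits {w₁ = false}        f≤t b≤b = inj₂ (inj₁ refl)
yval-mono-bits {w₁ = true}         f≤t b≤b = inj₁ refl
yval-mono-bits {b₁ = false}        b≤b f≤t = inj₂ (inj₁ refl)
yval-mono-bits {b₁ = true}         b≤b f≤t = inj₁ refl
yval-mono-bits                     f≤t f≤t = inj₁ refl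

yval-mono : ∀ {c₁ c₂} → c₁ ⊆ c₂ → yval c₁ ≼₄ yval c₂
yval-mono {_ ∷ _ ∷ []} {_ ∷ _ ∷ []} c₁⊆c₂ =
  yval-mono-bits (⊆⇒lookup-≤ c₁⊆c₂ zero) (⊆⇒lookup-≤ c₁⊆c₂ (suc zero))

yval-reflects : ∀ {c₁ c₂} → yval c₁ ≼₄ yval c₂ → c₁ ⊆ c₂
yval-reflects {c₁} {c₂} ≼y = subst₂ _⊆_ (color-yval c₁) (color-yval c₂) (color-mono ≼y)

module _ {k : ℕ} where

  csp-≡ : {p q : CSP k} → X p ≡ X q → Y p ≡ Y q → p ≡ q
  csp-≡ {csp _ _ _} {csp _ _ _} refl refl = refl

  Y≤X : (p : CSP k) → ∀ i → lookup (Y p) i ≤ᵇ lookup (X p) i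
  Y≤X (csp _ _ Y⊆X) i = recompute (_ ≤? _) (⊆⇒lookup-≤ Y⊆X i)

  tabulate-≼⇔ : {f g : Fin k → L₀} → tabulate f ≼ tabulate g ⇔ (∀ i → f i ≼₀ g i)
  tabulate-≼⇔ {f} {g} = mk⇔
    (λ f≼g i → subst₂ _≼₀_ (lookup∘tabulate f i) (lookup∘tabulate g i) (f≼g i))
    (λ f≼g i → subst₂ _≼₀_ (sym (lookup∘tabulate f i)) (sym (lookup∘tabulate g i)) (f≼g i))

  ≼-refl : (l : L* k) → l ≼ l
  ≼-refl _ i = ≤F-refl , inj₂ (inj₂ refl)

  ≼𝒮-antisym : {a₁ a₂ : 𝒮 k} → a₁ ≼𝒮 a₂ → a₂ ≼𝒮 a₁ → a₁ ≡ a₂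
  ≼𝒮-antisym ((Z₁⊆Z₂ , X₁⊆X₂) , c₁≤c₂) ((Z₂⊆Z₁ , X₂⊆X₁) , c₂≤c₁) =
    cong₂ _,_
      (csp-≡ (⊆-antisym X₁⊆X₂ X₂⊆X₁) (⊆-antisym (drop-∷-⊆ Z₁⊆Z₂) (drop-∷-⊆ Z₂⊆Z₁)))
      (Pointwise-≡⇒≡ (ext λ i → ⊆-antisym (c₁≤c₂ i) (c₂≤c₁ i)))

  ρ-order : ∀ a₁ a₂ → (a₁ ≼𝒮 a₂) ⇔ (ρ a₁ ≼ ρ a₂)
  ρ-order (p₁ , c₁) (p₂ , c₂) = mk⇔ monotone reflects
    where
    monotone : (p₁ , c₁) ≼𝒮 (p₂ , c₂) → ρ (p₁ , c₁) ≼ ρ (p₂ , c₂)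
    monotone ((Z₁⊆Z₂ , X₁⊆X₂) , c₁≤c₂) = Equivalence.from tabulate-≼⇔ λ i →
      xval-mono (⊆⇒lookup-≤ (drop-∷-⊆ Z₁⊆Z₂) i) (⊆⇒lookup-≤ X₁⊆X₂ i) , yval-mono (c₁≤c₂ i)

    reflects : ρ (p₁ , c₁) ≼ ρ (p₂ , c₂) → (p₁ , c₁) ≼𝒮 (p₂ , c₂)
    reflects ρ₁≼ρ₂ = (in⊆in (lookup-≤⇒⊆ (proj₁ ∘ bits≤)) , lookup-≤⇒⊆ (proj₂ ∘ bits≤)) ,
                     λ i → yval-reflects (proj₂ (cells≼ i))
      where
      cells≼ : ∀ i → (xcoord p₁ i , yval (lookup c₁ i)) ≼₀ (xcoord p₂ i , yval (lookup c₂ i))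
      cells≼ = Equivalence.to tabulate-≼⇔ ρ₁≼ρ₂
      bits≤ : ∀ i → lookup (Y p₁) i ≤ᵇ lookup (Y p₂) i × lookup (X p₁) i ≤ᵇ lookup (X p₂) i
      bits≤ i = xval-reflects (Y≤X p₁ i) (Y≤X p₂ i) (proj₁ (cells≼ i))

  ρ-surjective : ∀ l → Σ (𝒮 k) (λ a → ρ a ≡ l)
  ρ-surjective l = (csp Xˡ Yˡ Yˡ⊆Xˡ , cˡ) , trans (tabulate-cong ρ-lookup) (tabulate∘lookup l)
    where
    Xˡ Yˡ : Subset k
    Xˡ = tabulate (λ i → lbs-bit (proj₁ (lookup l i)))
    Yˡ = tabulate (λ i → z-bit (proj₁ (lookup l i)))
    cˡ : Coloring k
    cˡ = tabulate (λ i → color (proj₂ (lookup l i)))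

    Yˡ⊆Xˡ : Yˡ ⊆ Xˡ
    Yˡ⊆Xˡ = lookup-≤⇒⊆ λ i →
      subst₂ _≤ᵇ_ (sym (lookup∘tabulate _ i)) (sym (lookup∘tabulate _ i)) (z-bit≤lbs-bit _)

    ρ-lookup : ∀ i → (xval (lookup Yˡ i) (lookup Xˡ i) , yval (lookup cˡ i)) ≡ lookup l i
    ρ-lookup i = begin
      (xval (lookup Yˡ i) (lookup Xˡ i) , yval (lookup cˡ i))
        ≡⟨ cong₂ _,_ (cong₂ xval (lookup∘tabulate _ i) (lookup∘tabulate _ i))
                     (cong yval (lookup∘tabulate _ i)) ⟩
      (xval (z-bit x) (lbs-bit x) , yval (color y))
        ≡⟨ cong₂ _,_ (xval-bits x) (yval-color y) ⟩
      (x , y) ∎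
      where
      open ≡-Reasoning
      x : Fin 3
      x = proj₁ (lookup l i)
      y : Fin 4
      y = proj₂ (lookup l i)

  ρ-injective : ∀ a₁ a₂ → ρ a₁ ≡ ρ a₂ → a₁ ≡ a₂
  ρ-injective = order-reflecting⇒injective {_≤B_ = _≼_} ≼𝒮-antisym ≼-refl ρ
                  (λ a₁ a₂ → Equivalence.from (ρ-order a₁ a₂))

lemma4p5 : (k : ℕ) → 1 ≤ k → IsOrderIso (_≼𝒮_ {k}) (_≼_ {k}) ρ
lemma4p5 k _ = record
  { injective  = ρ-injective
  ; surjective = ρ-surjective
  ; order      = ρ-order
  }
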